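{- Let $M,N\in\mathcal{M}$ and $a,b\in\mathbb{A}$. (i) If $M\equiv^{ae}N$ then $M@[a]\equiv^{ae}N@[a]$. (ii) If $M\equiv^{ae}N$ and $a\simeq^{ae}b$ then $M@[a]\equiv^{ae}N@[b]$. (iii) Consequently, $\simeq^{ae}$ is a congruence on $(\mathbb{A},\cdot)$ (an equivalence relation compatible with $\cdot$).
   Context: Addressing machines. Fix a countable set $\mathbb{A}$ of addresses and a symbol $\varnothing\notin\mathbb{A}$; $\mathbb{A}_\varnothing=\mathbb{A}\cup\{\varnothing\}$. A tape is a finite list of elements of $\mathbb{A}$; $a::T$ has head $a$ and tail $T$, $T@T'$ is concatenation. A program is a finite list of instructions generated by $P::=\mathtt{Load}\ i;P\mid A$, $A::=\mathtt{App}(i,j,k);A\mid C$, $C::=\mathtt{Call}\ i\mid\varepsilon$ ($i,j,k\in\mathbb{N}$). For $r\in\mathbb{N}$, $I\subseteq\{0,\dots,r-1\}$, $I\models^r P$ is the least relation such that: $I\models^r\varepsilon$; $I\models^r\mathtt{Call}\ i$ if $i\in I$; $I\models^r\mathtt{App}(i,j,k);A$ if $i,j\in I$ and either ($k<r$ and $I\cup\{k\}\models^r A$) or ($k\ge r$ and $I\models^r A$); $I\models^r\mathtt{Load}\ i;P$ if either ($i<r$ and $I\cup\{i\}\models^r P$) or ($i\ge r$ and $I\models^r P$). An addressing machine is $M=\langle R_0,\dots,R_{r-1},P,T\rangle$ with registers in $\mathbb{A}_\varnothing$, $P$ valid w.r.t. the registers ($\{i<r\mid R_i\ne\varnothing\}\models^r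 P$), and a tape $T$; $\mathcal{M}$ is the set of all of them. $\vec R[R_i:=a]$ replaces $R_i$ by $a$ if $i<r$, is $\vec R$ if $i\ge r$. $M$ is stuck if $M.P=\mathtt{Load}\ i;P'$ and $M.T=[]$. Fix a bijection $\#:\mathcal{M}\to\mathbb{A}$ with inverse $\#^{ -1}$; $M@T'=\langle M.\vec R,M.P,M.T@T'\rangle$; $a\cdot b=\#(\#^{ -1}(a)@[b])$. Head reduction: $\langle\vec R,\mathtt{Load}\ i;P,a::T\rangle\to_h\langle\vec R[R_i:=a],P,T\rangle$, $\langle\vec R,\mathtt{App}(i,j,k);P,T\rangle\to_h\langle\vec R[R_k:=R_i\cdot R_j],P,T\rangle$, $\langle\vec R,\mathtt{Call}\ i,T\rangle\to_h\#^{ -1}(R_i)@T$; $\twoheadrightarrow_h$ reflexive-transitive closure; "$M\twoheadrightarrow_h\mathrm{stuck}$" means $M\twoheadrightarrow_h N$ for some stuck $N$. Induced relations: for a relation $\equiv_R$ on $\mathcal{M}$, $a\simeq_R b$ iff $\#^{ -1}(a)\equiv_R\#^{ -1}(b)$; on $\mathbb{A}_\varnothing$, both $\varnothing$ or both addresses related; componentwise on tuples/tapes of equal length; $M=_R N$ iff $M.\vec R\simeq_R N.\vec R$, $M.P=N.P$, $M.T\simeq_R N.T$. Applicative equivalence $\equiv^{ae}$ is the least equivalence relation on $\mathcal{M}$ such that: (1) if $M\twoheadrightarrow_h Z$ and $Z=^{ae}N$ then $M\equiv^{ae}N$; (2) if $M\twoheadrightarrow_h\mathrm{stuck}$, $N\twoheadrightarrow_h\mathrm{stuck}$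 and $M@[a]\equiv^{ae}N@[a]$ for all $a\in\mathbb{A}$, then $M\equiv^{ae}N$; $\simeq^{ae},=^{ae}$ are induced by $\equiv^{ae}$. -}

module Defs where

open import Data.Nat using (ℕ; zero; suc)
open import Data.Bool using (Bool; true; false)
open import Data.Maybe using (Maybe; just; nothing; is-just)
open import Data.Vec using (Vec; []; _∷_; toList)
import Data.Vec as Vec
open import Data.List using (List; _++_) renaming ([] to []ᴸ; _∷_ to _∷ᴸ_; [_] to [_]ᴸ)
open import Data.List.Relation.Binary.Pointwise using (Pointwise)
import Data.Maybe.Relation.Binary.Pointwise as MaybeRel
open import Data.Product using (Σ; _×_; ∃)
open import Relation.Binary.PropositionalEquality using (_≡_)
open import Function.Bundles using (_↔_; Inverse)

-- Out-of-range writes leave the vector unchanged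
-- (this is exactly R[R_i := a] for i ≥ r, and I ∪ {k} vs I for k ≥ r);
-- out-of-range reads return the supplied default.

updℕ : ∀ {X : Set} {n} → Vec X n → ℕ → X → Vec X n
updℕ []       _       _ = []
updℕ (y ∷ ys) zero    x = x ∷ ys
updℕ (y ∷ ys) (suc i) x = y ∷ updℕ ys i x

getℕ : ∀ {X : Set} {n} → X → Vec X n → ℕ → X
getℕ d []       _       = d
getℕ d (y ∷ ys) zero    = y
getℕ d (y ∷ ys) (suc i) = getℕ d ys i

data CProg : Set where
  Call : ℕ → CProg
  ε    : CProg

data AProg : Set where
  App  : ℕ → ℕ → ℕ → AProg → AProg
  cend : CProg → AProg

data Prog : Set where
  Load : ℕ → Prog → Prog
  aend : AProg → Prog

-- Validity  I ⊨^r P,  with I ⊆ {0,…,r-1} represented as a Vec Bool r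
-- (a subset of Fin r).  "i ∈ I" for i : ℕ means i < r and bit i is set.

_∈I_ : ∀ {r} → ℕ → Vec Bool r → Set
i ∈I I = getℕ false I i ≡ true

data _⊨C_ {r : ℕ} (I : Vec Bool r) : CProg → Set where
  ⊨ε    : I ⊨C ε
  ⊨Call : ∀ {i} → i ∈I I → I ⊨C Call i

data _⊨A_ {r : ℕ} (I : Vec Bool r) : AProg → Set where
  ⊨cend : ∀ {C} → I ⊨C C → I ⊨A cend C
  -- covers both cases k < r (I ∪ {k}) and k ≥ r (I unchanged)
  ⊨App  : ∀ {i j k A} → i ∈I I → j ∈I I → updℕ I k true ⊨A A →
          I ⊨A App i j k A

data _⊨P_ {r : ℕ} (I : Vec Bool r) : Prog → Set where
  ⊨aend : ∀ {A} → I ⊨A A → I ⊨P aend A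
  -- covers both cases i < r (I ∪ {i}) and i ≥ r (I unchanged)
  ⊨Load : ∀ {i P} → updℕ I i true ⊨P P → I ⊨P Load i P

-- Addressing machines over a set of addresses Addr
-- (registers range over A_∅ = Maybe Addr, with nothing = ∅).

module Machines (Addr : Set) where

  Tape : Set
  Tape = List Addr

  occupied : ∀ {r} → Vec (Maybe Addr) r → Vec Bool r
  occupied = Vec.map is-just

  -- validity is an irrelevant field, so a machine is determined by
  -- its registers, program and tape
  record Machine : Set where
    constructor mk
    field
      r      : ℕ
      R      : Vec (Maybe Addr) r
      P      : Prog
      .valid : occupied R ⊨P P
      T      : Tape

  open Machine public

  _＠_ : Machine → Tape → Machine
  mk r R P v T ＠ T' = mk r R P v (T ++ T')

  reg : ∀ {r} → Vec (Maybe Addr) r → ℕ → Maybe Addr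
  reg R i = getℕ nothing R i

  Stuck : Machine → Set
  Stuck M = Σ ℕ λ i → Σ Prog λ P' → (P M ≡ Load i P') × (T M ≡ []ᴸ)

module AE {Addr : Set} (bij : Machines.Machine Addr ↔ Addr) where
  open Machines Addr public

  # : Machine → Addr
  # = Inverse.to bij

  #⁻¹ : Addr → Machine
  #⁻¹ = Inverse.from bij

  _·_ : Addr → Addr → Addr
  a · b = # (#⁻¹ a ＠ [ b ]ᴸ)

  data _→h_ : Machine → Machine → Set where
    load : ∀ {r R i P a T} .{v v'} →
           mk r R (Load i P) v (a ∷ᴸ T) →h mk r (updℕ R i (just a)) P v' T
    app  : ∀ {r R i j k A T a b} .{v v'} →
           reg R i ≡ just a → reg R j ≡ just b →
           mk r R (aend (App i j k A)) v T →h
           mk r (updℕ R k (just (a · b))) (aend A) v' T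
    call : ∀ {r R i T a} .{v} →
           reg R i ≡ just a →
           mk r R (aend (cend (Call i))) v T →h (#⁻¹ a ＠ T)

  data _↠h_ : Machine → Machine → Set where
    done : ∀ {M} → M ↠h M
    step : ∀ {M N Z} → M →h N → N ↠h Z → M ↠h Z

  _↠stuck : Machine → Set
  M ↠stuck = ∃ λ N → (M ↠h N) × Stuck N

  -- Applicative equivalence: least equivalence relation closed under
  -- rules (1) and (2).  The induced relations are inlined so that the
  -- definition is strictly positive.
  mutual
    data _≡ae_ : Machine → Machine → Set where
      ae-refl  : ∀ {M} → M ≡ae M
      ae-sym   : ∀ {M N} → M ≡ae N → N ≡ae M
      ae-trans : ∀ {M N L} → M ≡ae N → N ≡ae L → M ≡ae L
      ae-red   : ∀ {M Z N} → M ↠h Z → Z =ae N → M ≡ae N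
      ae-ext   : ∀ {M N} → M ↠stuck → N ↠stuck →
                 (∀ a → (M ＠ [ a ]ᴸ) ≡ae (N ＠ [ a ]ᴸ)) → M ≡ae N

    record _≃ae_ (a b : Addr) : Set where
      inductive
      constructor ≃ae-intro
      field ≃ae-proof : #⁻¹ a ≡ae #⁻¹ b

    record _=ae_ (M N : Machine) : Set where
      inductive
      constructor =ae-intro
      field
        regs : Pointwise (MaybeRel.Pointwise _≃ae_) (toList (R M)) (toList (R N))
        prog : P M ≡ P N
        tape : Pointwise _≃ae_ (T M) (T N)

{-# OPTIONS --safe #-}
-- Appending to the tape commutes with head reduction and preserves =ae, so
-- every rule deriving M ≡ae N transports to M ＠ [a] ≡ae N ＠ [a]; for the
-- extensionality rule this instance is literally one of its premises.
-- Changing the appended address within its ≃ae-class is a single =ae step.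

module Submission where

open import Defs
open import Data.Nat using (ℕ)
open import Data.List using ([_]; _++_)
open import Data.List.Properties using (++-assoc)
open import Data.Product using (_×_; _,_)
open import Function.Bundles using (_↔_; Inverse)
open import Relation.Binary.Structures using (IsEquivalence)
open import Relation.Binary.PropositionalEquality using (_≡_; refl; cong; subst; subst₂; sym)
import Data.List.Relation.Binary.Pointwise as Pointwise
import Data.Maybe.Relation.Binary.Pointwise as MaybePointwise

module _ {Addr : Set} (bij : Machines.Machine Addr ↔ Addr) where
  open AE bij

  ≃ae-refl : ∀ {a} → a ≃ae a
  ≃ae-refl = ≃ae-intro ae-refl

  ＠-assoc : ∀ M T T′ → (M ＠ T) ＠ T′ ≡ M ＠ (T ++ T′)
  ＠-assoc (mk r R P v T₀) T T′ = cong (mk r R P v) (++-assoc T₀ T T′)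

  →h-＠ : ∀ {M N} T′ → M →h N → (M ＠ T′) →h (N ＠ T′)
  →h-＠ T′ load      = load
  →h-＠ T′ (app p q) = app p q
  →h-＠ T′ (call {r = r} {R = R} {i = i} {T = T} {a = a} {v = v} p) =
    subst (mk r R (aend (cend (Call i))) v (T ++ T′) →h_) (sym (＠-assoc (#⁻¹ a) T T′)) (call p)

  ↠h-＠ : ∀ {M N} T′ → M ↠h N → (M ＠ T′) ↠h (N ＠ T′)
  ↠h-＠ T′ done       = done
  ↠h-＠ T′ (step s r) = step (→h-＠ T′ s) (↠h-＠ T′ r)

  =ae-＠ : ∀ {M N} T′ → M =ae N → (M ＠ T′) =ae (N ＠ T′)
  =ae-＠ {mk _ _ _ _ _} {mk _ _ _ _ _} T′ (=ae-intro regs prog tape) =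
    =ae-intro regs prog (Pointwise.++⁺ tape (Pointwise.refl ≃ae-refl))

  ≡ae-＠ : ∀ {M N a} → M ≡ae N → (M ＠ [ a ]) ≡ae (N ＠ [ a ])
  ≡ae-＠ ae-refl          = ae-refl
  ≡ae-＠ (ae-sym p)       = ae-sym (≡ae-＠ p)
  ≡ae-＠ (ae-trans p q)   = ae-trans (≡ae-＠ p) (≡ae-＠ q)
  ≡ae-＠ (ae-red r z)     = ae-red (↠h-＠ _ r) (=ae-＠ _ z)
  ≡ae-＠ {a = a} (ae-ext _ _ f) = f a

  ＠-cong-≃ae : ∀ M {a b} → a ≃ae b → (M ＠ [ a ]) ≡ae (M ＠ [ b ])
  ＠-cong-≃ae (mk _ _ _ _ _) a≃b =
    ae-red done (=ae-intro (Pointwise.refl (MaybePointwise.refl ≃ae-refl)) refl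
                           (Pointwise.++⁺ (Pointwise.refl ≃ae-refl) (a≃b Pointwise.∷ Pointwise.[])))

  ≡ae-＠-≃ae : ∀ {M N a b} → M ≡ae N → a ≃ae b → (M ＠ [ a ]) ≡ae (N ＠ [ b ])
  ≡ae-＠-≃ae {N = N} M≡N a≃b = ae-trans (≡ae-＠ M≡N) (＠-cong-≃ae N a≃b)

  ≃ae-isEquivalence : IsEquivalence _≃ae_
  ≃ae-isEquivalence = record
    { refl  = ≃ae-refl
    ; sym   = λ { (≃ae-intro p) → ≃ae-intro (ae-sym p) }
    ; trans = λ { (≃ae-intro p) (≃ae-intro q) → ≃ae-intro (ae-trans p q) }
    }

  ·-cong-≃ae : ∀ {a a′ b b′} → a ≃ae a′ → b ≃ae b′ → (a · b) ≃ae (a′ · b′)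
  ·-cong-≃ae (≃ae-intro a≡a′) b≃b′ =
    ≃ae-intro (subst₂ _≡ae_ (sym (#⁻¹∘# _)) (sym (#⁻¹∘# _)) (≡ae-＠-≃ae a≡a′ b≃b′))
    where
    #⁻¹∘# : ∀ M → #⁻¹ (# M) ≡ M
    #⁻¹∘# = Inverse.strictlyInverseʳ bij

lemma4p4 : (Addr : Set) → Addr ↔ ℕ → (bij : Machines.Machine Addr ↔ Addr) →
    let open AE bij in
    (∀ {M N : Machine} {a : Addr} → M ≡ae N → (M ＠ [ a ]) ≡ae (N ＠ [ a ]))
    × (∀ {M N : Machine} {a b : Addr} → M ≡ae N → a ≃ae b → (M ＠ [ a ]) ≡ae (N ＠ [ b ]))
    × (IsEquivalence _≃ae_
       × (∀ {a a′ b b′ : Addr} → a ≃ae a′ → b ≃ae b′ → (a · b) ≃ae (a′ · b′)))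
lemma4p4 _ _ bij =
  ≡ae-＠ bij , ≡ae-＠-≃ae bij , ≃ae-isEquivalence bij , ·-cong-≃ae bij
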